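{- For $k\ge1$ let $\Theta_k$ be the set of rationals $x\in(0,1)$ whose regular reduced continued fraction expansion $x=[[1;b_1,\ldots,b_l]]$ satisfies $b_1+\cdots+b_l=k+1$. Then $\#\Theta_1=1$, $\#\Theta_2=1$, and $\#\Theta_{n+1}=\#\Theta_n+\#\Theta_{n-1}$ for $n\ge2$; consequently $\#\Theta_n=F_n$ for all $n\ge1$, where $F_n=\frac{1}{\sqrt5}\left(\left(\frac{1+\sqrt5}{2}\right)^n-\left(\frac{1-\sqrt5}{2}\right)^n\right)$ is the $n$-th Fibonacci number.
   Context: Every rational $x\in(0,1)$ has a unique regular reduced continued fraction expansion $x = [[1;b_1,\ldots,b_l]] = 1-\cfrac{1}{b_1-\cfrac{1}{b_2-\cdots-\cfrac{1}{b_l}}}$ with integers $b_i\ge 2$. -}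

module Defs where

open import Data.Nat as ℕ using (ℕ; zero; suc; _+_)
open import Data.Integer using (+_)
open import Data.Rational as ℚ using (ℚ; 0ℚ; 1ℚ; _-_; 1/_; _/_; ≢-nonZero)
open import Data.Rational.Properties using (_≟_)
open import Data.List using (List; []; _∷_; length)
open import Data.Nat.ListAction using (sum)
open import Data.List.Relation.Unary.All using (All)
open import Data.List.Relation.Unary.Unique.Propositional using (Unique)
open import Data.List.Membership.Propositional using (_∈_)
open import Data.Product using (Σ; _×_)
open import Relation.Nullary using (yes; no)
open import Relation.Binary.PropositionalEquality using (_≡_)

-- Total reciprocal on ℚ (junk value 0 at 0; never used on the expansions
-- considered, where all intermediate values are > 1).
inv : ℚ → ℚ
inv p with p ≟ 0ℚ
... | yes _ = 0ℚ
... | no p≢0 = 1/_ p {{≢-nonZero p≢0}}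

cf : List ℕ → ℚ
cf [] = 0ℚ
cf (b ∷ []) = + b / 1
cf (b ∷ bs@(_ ∷ _)) = (+ b / 1) - inv (cf bs)

-- [[1; b₁, …, bₗ]] = 1 - 1/(b₁ - 1/(b₂ - ⋯ - 1/bₗ))
rrcf : List ℕ → ℚ
rrcf bs = 1ℚ - inv (cf bs)

-- Θ k : rationals x ∈ (0,1) whose regular reduced continued fraction
-- expansion [[1; b₁, …, bₗ]] (all bᵢ ≥ 2) has b₁ + ⋯ + bₗ = k + 1.
-- (The expansion is unique, so "some such expansion" = "the expansion".)
Θ : ℕ → ℚ → Set
Θ k x = (0ℚ ℚ.< x) × (x ℚ.< 1ℚ) ×
        Σ (List ℕ) (λ bs → All (2 ℕ.≤_) bs × (sum bs ≡ suc k) × (rrcf bs ≡ x))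

HasCard : (ℚ → Set) → ℕ → Set
HasCard P n = Σ (List ℚ) λ xs →
  Unique xs × ((∀ x → P x → x ∈ xs) × (∀ x → x ∈ xs → P x)) × (length xs ≡ n)

-- Fibonacci numbers F₀ = 0, F₁ = 1, F_{n+2} = F_{n+1} + F_n
-- (equal to Binet's formula in the statement).
fib : ℕ → ℕ
fib 0 = 0
fib 1 = 1
fib (suc (suc n)) = fib (suc n) + fib n

-- For an expansion with all bᵢ ≥ 2 one has cf bs > 1 (unless bs = []), so
-- cf (b ∷ bs) = b - 1/cf bs with 1/cf bs ∈ [0,1): the value determines b, and
-- then bs inductively. Hence rrcf is injective on such expansions, and Θ k is
-- in bijection with the compositions of k + 1 into parts ≥ 2. Splitting those
-- by whether the first part is 2 gives the Fibonacci recursion.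
module Submission where

open import Data.Nat as ℕ using (ℕ; zero; suc; z≤n; s≤s)
import Data.Nat.Properties as ℕ
open import Data.Integer as ℤ using (+_)
import Data.Integer.Properties as ℤ
open import Data.Rational as ℚ
  using (ℚ; mkℚ; 0ℚ; 1ℚ; _+_; _-_; -_; _*_; 1/_; _/_; _<_; _≤_; *<*; toℚᵘ; Positive; NonNegative; NonZero)
open import Data.Rational.Properties
import Data.Rational.Unnormalised as ℚᵘ
import Data.Rational.Unnormalised.Properties as ℚᵘ
open import Algebra.Properties.Group +-0-group using (∙-cancelˡ; ⁻¹-injective; //-rightDividesʳ)
open import Data.Nat.Coprimality as Coprime using (Coprime)
open import Data.List using (List; []; _∷_; map; _++_; length)
open import Data.List.Properties using (length-map; length-++; ∷-injectiveʳ)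
open import Data.Nat.ListAction using (sum)
open import Data.List.Relation.Unary.All as All using (All; []; _∷_)
import Data.List.Relation.Unary.All.Properties as All
open import Data.List.Relation.Unary.Any using (here; there)
open import Data.List.Relation.Unary.AllPairs using ([]; _∷_)
open import Data.List.Relation.Unary.Unique.Propositional using (Unique)
import Data.List.Relation.Unary.Unique.Propositional.Properties as Unique
open import Data.List.Membership.Propositional using (_∈_)
open import Data.List.Membership.Propositional.Properties using (∈-map⁺; ∈-map⁻; ∈-++⁺ˡ; ∈-++⁺ʳ)
open import Data.Product using (Σ; _×_; _,_; proj₁; proj₂; map₁; map₂)
open import Data.Sum using (inj₁; inj₂)
open import Data.Empty using (⊥-elim)
open import Relation.Binary using (tri<; tri≈; tri>)
open import Relation.Nullary using (yes; no; ¬_)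
open import Relation.Binary.PropositionalEquality
open import Defs

unique-map⁺ : ∀ {A B : Set} {f : A → B} {xs : List A} →
              (∀ {x y} → x ∈ xs → y ∈ xs → f x ≡ f y → x ≡ y) → Unique xs → Unique (map f xs)
unique-map⁺ {xs = []} _ [] = []
unique-map⁺ {xs = _ ∷ _} f-inj (x∉xs ∷ xs-unique) =
  All.map⁺ (All.tabulate λ y∈ fx≡fy → All.lookup x∉xs y∈ (f-inj (here refl) (there y∈) fx≡fy))
  ∷ unique-map⁺ (λ x∈ y∈ → f-inj (there x∈) (there y∈)) xs-unique

fromℕ : ℕ → ℚ
fromℕ n = + n / 1

fromℕ-normal : ∀ n → fromℕ n ≡ mkℚ (+ n) 0 (Coprime.recompute (Coprime.sym (Coprime.1-coprimeTo n)))
fromℕ-normal n = normalize-coprime (Coprime.sym (Coprime.1-coprimeTo n))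

fromℕ-mono-< : ∀ {m n} → m ℕ.< n → fromℕ m < fromℕ n
fromℕ-mono-< {m} {n} m<n rewrite fromℕ-normal m | fromℕ-normal n =
  *<* (subst₂ ℤ._<_ (sym (ℤ.*-identityʳ (+ m))) (sym (ℤ.*-identityʳ (+ n))) (ℤ.+<+ m<n))

fromℕ-mono-≤ : ∀ {m n} → m ℕ.≤ n → fromℕ m ≤ fromℕ n
fromℕ-mono-≤ m≤n with ℕ.m≤n⇒m<n∨m≡n m≤n
... | inj₁ m<n = <⇒≤ (fromℕ-mono-< m<n)
... | inj₂ refl = ≤-refl

fromℕ-suc : ∀ n → fromℕ (suc n) ≡ fromℕ n + 1ℚ
fromℕ-suc n = toℚᵘ-injective (ℚᵘ.≃-trans unnormalised (ℚᵘ.≃-sym (toℚᵘ-homo-+ (fromℕ n) 1ℚ)))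
  where
  unnormalised : toℚᵘ (fromℕ (suc n)) ℚᵘ.≃ toℚᵘ (fromℕ n) ℚᵘ.+ toℚᵘ 1ℚ
  unnormalised rewrite fromℕ-normal n | fromℕ-normal (suc n)
                     | ℕ.*-identityʳ n | ℤ.+◃n≡+n n | ℕ.+-comm n 1 = ℚᵘ.*≡* refl

0<1 : 0ℚ < 1ℚ
0<1 = fromℕ-mono-< {0} {1} (s≤s z≤n)

fromℕ-sub-< : ∀ {m n s t} → m ℕ.< n → 0ℚ ≤ t → s < 1ℚ → fromℕ m - t < fromℕ n - s
fromℕ-sub-< {m} {suc n} {s} {t} (s≤s m≤n) 0≤t s<1 = begin-strict
  fromℕ m - t           ≤⟨ +-monoʳ-≤ (fromℕ m) (neg-antimono-≤ 0≤t) ⟩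
  fromℕ m - 0ℚ          ≡⟨ +-identityʳ (fromℕ m) ⟩
  fromℕ m               ≤⟨ fromℕ-mono-≤ m≤n ⟩
  fromℕ n               ≡⟨ sym (//-rightDividesʳ 1ℚ (fromℕ n)) ⟩
  fromℕ n + 1ℚ - 1ℚ     ≡⟨ cong (_- 1ℚ) (sym (fromℕ-suc n)) ⟩
  fromℕ (suc n) - 1ℚ    <⟨ +-monoʳ-< (fromℕ (suc n)) (neg-antimono-< s<1) ⟩
  fromℕ (suc n) - s     ∎
  where open ≤-Reasoning

sub-cancelˡ : ∀ p {q r} → p - q ≡ p - r → q ≡ r
sub-cancelˡ p {q} {r} eq = ⁻¹-injective (∙-cancelˡ p (- q) (- r) eq)

fromℕ-sub-injective : ∀ {m n s t} → 0ℚ ≤ s × s < 1ℚ → 0ℚ ≤ t × t < 1ℚ →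
                      fromℕ m - s ≡ fromℕ n - t → m ≡ n × s ≡ t
fromℕ-sub-injective {m} {n} (0≤s , s<1) (0≤t , t<1) eq with ℕ.<-cmp m n
... | tri< m<n _ _ = ⊥-elim (<-irrefl eq (fromℕ-sub-< m<n 0≤s t<1))
... | tri≈ _ refl _ = refl , sub-cancelˡ (fromℕ m) eq
... | tri> _ _ n<m = ⊥-elim (<-irrefl (sym eq) (fromℕ-sub-< n<m 0≤t s<1))

inv-nonZero : ∀ p (p≢0 : p ≢ 0ℚ) → inv p ≡ (1/ p) {{ℚ.≢-nonZero p≢0}}
inv-nonZero p p≢0 with p ≟ 0ℚ
... | yes p≡0 = ⊥-elim (p≢0 p≡0)
... | no _ = refl

inv-involutive : ∀ p → inv (inv p) ≡ p
inv-involutive p with p ≟ 0ℚ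
... | yes refl = refl
... | no p≢0 = trans (inv-nonZero _ 1/p≢0) (1/-involutive p {{ℚ.≢-nonZero p≢0}})
  where
  instance
    p≠0 : NonZero p
    p≠0 = ℚ.≢-nonZero p≢0
  1/p≢0 : 1/ p ≢ 0ℚ
  1/p≢0 1/p≡0 = 1≢0 (trans (sym (*-inverseʳ p)) (trans (cong (p *_) 1/p≡0) (*-zeroʳ p)))

inv-injective : ∀ {p q} → inv p ≡ inv q → p ≡ q
inv-injective {p} {q} eq = trans (sym (inv-involutive p)) (trans (cong inv eq) (inv-involutive q))

1<⇒≢0 : ∀ {p} → 1ℚ < p → p ≢ 0ℚ
1<⇒≢0 1<p refl = <-asym 1<p 0<1

0<inv<1 : ∀ {p} → 1ℚ < p → 0ℚ < inv p × inv p < 1ℚ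
0<inv<1 {p} 1<p rewrite inv-nonZero p (1<⇒≢0 1<p) = positive⁻¹ (1/ p) {{1/pos⇒pos p}} , ≰⇒> 1≰1/p
  where
  instance
    p>0 : Positive p
    p>0 = ℚ.positive (<-trans 0<1 1<p)
    p≥0 : NonNegative p
    p≥0 = pos⇒nonNeg p
    p≠0 : NonZero p
    p≠0 = pos⇒nonZero p
  1≰1/p : ¬ (1ℚ ≤ 1/ p)
  1≰1/p 1≤1/p = <-irrefl refl (<-≤-trans 1<p p≤1)
    where
    p≤1 : p ≤ 1ℚ
    p≤1 = subst₂ _≤_ (*-identityˡ p) (*-inverseˡ p) (*-monoʳ-≤-nonNeg p 1≤1/p)

-- For bs = [] this uses the junk value inv 0ℚ = 0ℚ.
cf-∷ : ∀ b bs → cf (b ∷ bs) ≡ fromℕ b - inv (cf bs)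
cf-∷ b [] = sym (+-identityʳ (fromℕ b))
cf-∷ b (_ ∷ _) = refl

1<cf-∷ : ∀ {b bs} → 2 ℕ.≤ b → inv (cf bs) < 1ℚ → 1ℚ < cf (b ∷ bs)
1<cf-∷ {b} {bs} b≥2 inv<1 = subst (1ℚ <_) (sym (cf-∷ b bs)) (fromℕ-sub-< {1} {b} b≥2 ≤-refl inv<1)

0≤inv-cf<1 : ∀ {bs} → All (2 ℕ.≤_) bs → 0ℚ ≤ inv (cf bs) × inv (cf bs) < 1ℚ
0≤inv-cf<1 [] = ≤-refl , 0<1
0≤inv-cf<1 {b ∷ bs} (b≥2 ∷ bs≥2) = map₁ <⇒≤ (0<inv<1 (1<cf-∷ {b} {bs} b≥2 (proj₂ (0≤inv-cf<1 bs≥2))))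

1<cf : ∀ {b bs} → All (2 ℕ.≤_) (b ∷ bs) → 1ℚ < cf (b ∷ bs)
1<cf {b} {bs} (b≥2 ∷ bs≥2) = 1<cf-∷ {b} {bs} b≥2 (proj₂ (0≤inv-cf<1 bs≥2))

cf-∷-cancel : ∀ {b bs c cs} → All (2 ℕ.≤_) bs → All (2 ℕ.≤_) cs →
              cf (b ∷ bs) ≡ cf (c ∷ cs) → b ≡ c × cf bs ≡ cf cs
cf-∷-cancel {b} {bs} {c} {cs} bs≥2 cs≥2 eq =
  map₂ inv-injective (fromℕ-sub-injective (0≤inv-cf<1 bs≥2) (0≤inv-cf<1 cs≥2)
                                          (trans (sym (cf-∷ b bs)) (trans eq (cf-∷ c cs))))

cf-injective : ∀ {bs cs} → All (2 ℕ.≤_) bs → All (2 ℕ.≤_) cs → cf bs ≡ cf cs → bs ≡ cs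
cf-injective [] [] _ = refl
cf-injective [] cs≥2@(_ ∷ _) eq = ⊥-elim (<-asym (1<cf cs≥2) (subst (_< 1ℚ) eq 0<1))
cf-injective bs≥2@(_ ∷ _) [] eq = ⊥-elim (<-asym (1<cf bs≥2) (subst (_< 1ℚ) (sym eq) 0<1))
cf-injective (_ ∷ bs≥2) (_ ∷ cs≥2) eq with cf-∷-cancel bs≥2 cs≥2 eq
... | refl , tail-eq = cong (_ ∷_) (cf-injective bs≥2 cs≥2 tail-eq)

rrcf-injective : ∀ {bs cs} → All (2 ℕ.≤_) bs → All (2 ℕ.≤_) cs → rrcf bs ≡ rrcf cs → bs ≡ cs
rrcf-injective bs≥2 cs≥2 eq = cf-injective bs≥2 cs≥2 (inv-injective (sub-cancelˡ 1ℚ eq))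

0<rrcf<1 : ∀ {b bs} → All (2 ℕ.≤_) (b ∷ bs) → 0ℚ < rrcf (b ∷ bs) × rrcf (b ∷ bs) < 1ℚ
0<rrcf<1 {b} {bs} bs≥2 with 0<inv<1 (1<cf bs≥2)
... | 0<inv , inv<1 =
  subst (_< rrcf (b ∷ bs)) (+-inverseʳ 1ℚ) (+-monoʳ-< 1ℚ (neg-antimono-< inv<1)) ,
  subst (rrcf (b ∷ bs) <_) (+-identityʳ 1ℚ) (+-monoʳ-< 1ℚ (neg-antimono-< 0<inv))

IsComposition≥2 : ℕ → List ℕ → Set
IsComposition≥2 m bs = All (2 ℕ.≤_) bs × sum bs ≡ m

incrementHead : List ℕ → List ℕ
incrementHead [] = []
incrementHead (b ∷ bs) = suc b ∷ bs

-- A composition of m + 2 starts with 2 followed by a composition of m, or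
-- arises from a composition of m + 1 by incrementing its first part.
compositions≥2 : ℕ → List (List ℕ)
compositions≥2 0 = [] ∷ []
compositions≥2 1 = []
compositions≥2 (suc (suc m)) =
  map (2 ∷_) (compositions≥2 m) ++ map incrementHead (compositions≥2 (suc m))

incrementHead-isComposition≥2 : ∀ {m bs} → IsComposition≥2 (suc m) bs →
                                 IsComposition≥2 (suc (suc m)) (incrementHead bs)
incrementHead-isComposition≥2 {bs = _ ∷ _} (b≥2 ∷ bs≥2 , sum≡) = ℕ.m≤n⇒m≤1+n b≥2 ∷ bs≥2 , cong suc sum≡

cons2-isComposition≥2 : ∀ {m bs} → IsComposition≥2 m bs → IsComposition≥2 (suc (suc m)) (2 ∷ bs)
cons2-isComposition≥2 (bs≥2 , sum≡) = s≤s (s≤s z≤n) ∷ bs≥2 , cong (2 ℕ.+_) sum≡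

compositions≥2-sound : ∀ m → All (IsComposition≥2 m) (compositions≥2 m)
compositions≥2-sound 0 = ([] , refl) ∷ []
compositions≥2-sound 1 = []
compositions≥2-sound (suc (suc m)) =
  All.++⁺ (All.map⁺ (All.map cons2-isComposition≥2 (compositions≥2-sound m)))
          (All.map⁺ (All.map incrementHead-isComposition≥2 (compositions≥2-sound (suc m))))

compositions≥2-complete : ∀ m {bs} → IsComposition≥2 m bs → bs ∈ compositions≥2 m
compositions≥2-complete _ {0 ∷ _} (() ∷ _ , _)
compositions≥2-complete _ {1 ∷ _} (s≤s () ∷ _ , _)
compositions≥2-complete zero {[]} _ = here refl
compositions≥2-complete zero {suc (suc _) ∷ _} (_ , ())
compositions≥2-complete (suc zero) {suc (suc _) ∷ _} (_ , ())
compositions≥2-complete (suc (suc m)) {2 ∷ bs} (_ ∷ bs≥2 , refl) =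
  ∈-++⁺ˡ (∈-map⁺ (2 ∷_) (compositions≥2-complete m (bs≥2 , refl)))
compositions≥2-complete (suc (suc m)) {suc (suc (suc b)) ∷ bs} (_ ∷ bs≥2 , refl) =
  ∈-++⁺ʳ (map (2 ∷_) (compositions≥2 m))
    (∈-map⁺ incrementHead (compositions≥2-complete (suc m) (s≤s (s≤s z≤n) ∷ bs≥2 , refl)))

incrementHead-injective : ∀ {bs cs} → incrementHead bs ≡ incrementHead cs → bs ≡ cs
incrementHead-injective {[]} {[]} _ = refl
incrementHead-injective {_ ∷ _} {_ ∷ _} refl = refl

incrementHead-≢-2∷ : ∀ {m bs cs} → IsComposition≥2 (suc m) cs → incrementHead cs ≢ 2 ∷ bs
incrementHead-≢-2∷ {cs = []} (_ , ())
incrementHead-≢-2∷ {cs = 1 ∷ _} (s≤s () ∷ _ , _)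
incrementHead-≢-2∷ {cs = suc (suc _) ∷ _} _ ()

compositions≥2-unique : ∀ m → Unique (compositions≥2 m)
compositions≥2-unique 0 = [] ∷ []
compositions≥2-unique 1 = []
compositions≥2-unique (suc (suc m)) =
  Unique.++⁺ (Unique.map⁺ ∷-injectiveʳ (compositions≥2-unique m))
             (Unique.map⁺ incrementHead-injective (compositions≥2-unique (suc m)))
             disjoint
  where
  disjoint : ∀ {bs} → ¬ (bs ∈ map (2 ∷_) (compositions≥2 m) × bs ∈ map incrementHead (compositions≥2 (suc m)))
  disjoint (bs∈ˡ , bs∈ʳ) with ∈-map⁻ (2 ∷_) bs∈ˡ | ∈-map⁻ incrementHead bs∈ʳ
  ... | _ , _ , refl | cs , cs∈ , eq =
    incrementHead-≢-2∷ (All.lookup (compositions≥2-sound (suc m)) cs∈) (sym eq)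

length-compositions≥2 : ∀ k → length (compositions≥2 (suc k)) ≡ fib k
length-compositions≥2 0 = refl
length-compositions≥2 1 = refl
length-compositions≥2 (suc (suc k)) = begin
  length (map (2 ∷_) (compositions≥2 (suc k)) ++ map incrementHead (compositions≥2 (suc (suc k))))
    ≡⟨ length-++ (map (2 ∷_) (compositions≥2 (suc k))) ⟩
  length (map (2 ∷_) (compositions≥2 (suc k))) ℕ.+ length (map incrementHead (compositions≥2 (suc (suc k))))
    ≡⟨ cong₂ ℕ._+_ (length-map (2 ∷_) (compositions≥2 (suc k)))
                   (length-map incrementHead (compositions≥2 (suc (suc k)))) ⟩
  length (compositions≥2 (suc k)) ℕ.+ length (compositions≥2 (suc (suc k)))
    ≡⟨ cong₂ ℕ._+_ (length-compositions≥2 k) (length-compositions≥2 (suc k)) ⟩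
  fib k ℕ.+ fib (suc k)
    ≡⟨ ℕ.+-comm (fib k) (fib (suc k)) ⟩
  fib (suc (suc k)) ∎
  where open ≡-Reasoning

Θ-card : ∀ k → HasCard (Θ k) (fib k)
Θ-card k = map rrcf expansions
         , unique-map⁺ rrcf-injectiveOn (compositions≥2-unique (suc k))
         , (Θ⇒∈ , ∈⇒Θ)
         , trans (length-map rrcf expansions) (length-compositions≥2 k)
  where
  expansions : List (List ℕ)
  expansions = compositions≥2 (suc k)
  rrcf-injectiveOn : ∀ {bs cs} → bs ∈ expansions → cs ∈ expansions → rrcf bs ≡ rrcf cs → bs ≡ cs
  rrcf-injectiveOn bs∈ cs∈ = rrcf-injective (proj₁ (All.lookup (compositions≥2-sound (suc k)) bs∈))
                                            (proj₁ (All.lookup (compositions≥2-sound (suc k)) cs∈))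
  Θ⇒∈ : ∀ x → Θ k x → x ∈ map rrcf expansions
  Θ⇒∈ x (_ , _ , bs , bs≥2 , sum≡ , refl) = ∈-map⁺ rrcf (compositions≥2-complete (suc k) (bs≥2 , sum≡))
  ∈⇒Θ : ∀ x → x ∈ map rrcf expansions → Θ k x
  ∈⇒Θ x x∈ with ∈-map⁻ rrcf x∈
  ... | bs , bs∈ , refl with All.lookup (compositions≥2-sound (suc k)) bs∈
  ∈⇒Θ x x∈ | b ∷ bs , _ , refl | bs≥2 , sum≡ =
    proj₁ (0<rrcf<1 bs≥2) , proj₂ (0<rrcf<1 bs≥2) , b ∷ bs , bs≥2 , sum≡ , refl

lemma2 : HasCard (Θ 1) 1 × HasCard (Θ 2) 1
    × (∀ n → 2 ℕ.≤ n → Σ ℕ λ a → Σ ℕ λ b → Σ ℕ λ c →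
         HasCard (Θ (suc n)) a × HasCard (Θ n) b × HasCard (Θ (n ℕ.∸ 1)) c × a ≡ b ℕ.+ c)
    × (∀ n → 1 ℕ.≤ n → HasCard (Θ n) (fib n))
lemma2 = Θ-card 1 , Θ-card 2 , recurrence , λ n _ → Θ-card n
  where
  recurrence : ∀ n → 2 ℕ.≤ n → Σ ℕ λ a → Σ ℕ λ b → Σ ℕ λ c →
    HasCard (Θ (suc n)) a × HasCard (Θ n) b × HasCard (Θ (n ℕ.∸ 1)) c × a ≡ b ℕ.+ c
  recurrence (suc n) _ = fib (suc (suc n)) , fib (suc n) , fib n
                       , Θ-card (suc (suc n)) , Θ-card (suc n) , Θ-card n , refl
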